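{- Let $\Lambda$ be a finite abelian subgroup of $(\mathbb{R}/\mathbb{Z})^e$ with $\deg(\Lambda)=s$. Then $\mathrm{wt}(x)\le 2s$ for every $x\in\Lambda$.
   Context: Each $x=(x_1,\dots,x_e)\in(\mathbb{R}/\mathbb{Z})^e$ is written with representatives $0\le x_i<1$. Define $\mathrm{ht}(x)=\sum_i x_i$, $\mathrm{supp}(x)=\{i: x_i\neq0\}$, $\mathrm{wt}(x)=|\mathrm{supp}(x)|$, and for a subgroup $\Lambda$, $\deg(\Lambda)=\max\{\mathrm{ht}(x):x\in\Lambda\}$.
   Formalization: Points of $(\mathbb{R}/\mathbb{Z})^e$ are taken with rational coordinates, so Λ lies in (ℚ/ℤ)^e and the degree s is rational. -}

module Defs where

open import Data.Nat using (ℕ; suc)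
open import Data.Integer using (+_)
open import Data.Rational using (ℚ; 0ℚ; 1ℚ; _+_; _-_; -_; _≤_; _<_; _/_; floor; _≟_)
open import Data.Product using (_×_; ∃-syntax)
open import Data.Vec using (Vec; []; _∷_; zipWith; replicate; map)
open import Data.Vec.Relation.Unary.All using (All)
open import Data.List using (List)
open import Data.List.Membership.Propositional using (_∈_)
open import Relation.Nullary using (yes; no)
open import Relation.Binary.PropositionalEquality using (_≡_)

frac : ℚ → ℚ
frac q = q - (floor q / 1)

-- a point of (ℚ/ℤ)^e ⊆ (ℝ/ℤ)^e, given by representatives
Pt : ℕ → Set
Pt e = Vec ℚ e

Reduced : ∀ {e} → Pt e → Set
Reduced x = All (λ q → (0ℚ ≤ q) × (q < 1ℚ)) x

_⊕_ : ∀ {e} → Pt e → Pt e → Pt e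
x ⊕ y = zipWith (λ a b → frac (a + b)) x y

⊖_ : ∀ {e} → Pt e → Pt e
⊖ x = map (λ a → frac (- a)) x

𝟘 : ∀ {e} → Pt e
𝟘 = replicate _ 0ℚ

record IsFiniteSubgroup {e : ℕ} (Λ : List (Pt e)) : Set where
  field
    reduced : ∀ x → x ∈ Λ → Reduced x
    has-zero : 𝟘 ∈ Λ
    closed-add : ∀ x y → x ∈ Λ → y ∈ Λ → (x ⊕ y) ∈ Λ
    closed-neg : ∀ x → x ∈ Λ → (⊖ x) ∈ Λ

ht : ∀ {e} → Pt e → ℚ
ht [] = 0ℚ
ht (q ∷ x) = q + ht x

wt : ∀ {e} → Pt e → ℕ
wt [] = 0
wt (q ∷ x) with q ≟ 0ℚ
... | yes _ = wt x
... | no _ = suc (wt x)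

DegIs : ∀ {e} → List (Pt e) → ℚ → Set
DegIs Λ s = (∃[ x ] ((x ∈ Λ) × (ht x ≡ s))) × (∀ x → x ∈ Λ → ht x ≤ s)

{-# OPTIONS --safe #-}
-- For a coordinate 0 ≤ q < 1, the representative of -q is frac (-q), and
-- q + frac (-q) = ⌈q⌉, which is 0 if q = 0 and 1 otherwise.  Summing over the
-- coordinates gives wt x ≤ ht x + ht (-x), and both heights are at most s
-- because -x ∈ Λ.
module Submission where

open import Defs
open import Algebra.Bundles using (CommutativeMonoid)
open import Data.Integer as ℤ using (ℤ; +_; -[1+_]; +<+; +≤+)
import Data.Integer.Properties as ℤ
open import Data.List using (List)
open import Data.List.Membership.Propositional using (_∈_)
open import Data.Nat using (ℕ; suc; s≤s; z≤n)
import Data.Nat.Coprimality as Coprimality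
open import Data.Product using (_,_)
open import Data.Rational
  using (ℚ; mkℚ; 0ℚ; 1ℚ; _+_; -_; _-_; _*_; _/_; _≤_; _<_; *≤*; *<*; floor; ceiling; _≤?_; _≟_)
open import Data.Rational.Properties
open import Data.Rational.Unnormalised using (*≡*)
import Data.Rational.Unnormalised.Properties as ℚᵘ
open import Data.Vec using (_∷_; [])
open import Data.Vec.Relation.Unary.All using (_∷_)
open import Function using (_∘_)
open import Relation.Binary.PropositionalEquality using (_≡_; _≢_; refl; cong; cong₂; sym; module ≡-Reasoning)
open import Relation.Nullary using (yes; no; contradiction)

open import Algebra.Properties.CommutativeSemigroup
  (CommutativeMonoid.commutativeSemigroup +-0-commutativeMonoid) using (interchange)

fromℤ : ℤ → ℚ
fromℤ i = mkℚ i 0 (Coprimality.sym (Coprimality.1-coprimeTo ℤ.∣ i ∣))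

/1≡fromℤ : ∀ i → i / 1 ≡ fromℤ i
/1≡fromℤ i = ↥p/↧p≡p (fromℤ i)

/1-homo-+ : ∀ i j → (i ℤ.+ j) / 1 ≡ i / 1 + j / 1
/1-homo-+ i j rewrite /1≡fromℤ (i ℤ.+ j) | /1≡fromℤ i | /1≡fromℤ j =
  toℚᵘ-injective (ℚᵘ.≃-sym (ℚᵘ.≃-trans (toℚᵘ-homo-+ (fromℤ i) (fromℤ j))
    (*≡* (cong (ℤ._* + 1) (cong₂ ℤ._+_ (ℤ.*-identityʳ i) (ℤ.*-identityʳ j))))))

0</1⇒1≤/1 : ∀ i → 0ℚ < i / 1 → 1ℚ ≤ i / 1
0</1⇒1≤/1 i rewrite /1≡fromℤ i = positive⇒1≤ i
  where
  positive⇒1≤ : ∀ i → 0ℚ < fromℤ i → 1ℚ ≤ fromℤ i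
  positive⇒1≤ (+ 0)     (*<* (+<+ ()))
  positive⇒1≤ (+ suc n) _ = *≤* (+≤+ (s≤s z≤n))
  positive⇒1≤ -[1+ n ]  (*<* ())

neg-/1 : ∀ i → - (i / 1) ≡ (ℤ.- i) / 1
neg-/1 i rewrite /1≡fromℤ i | /1≡fromℤ (ℤ.- i) = neg-fromℤ i
  where
  neg-fromℤ : ∀ i → - fromℤ i ≡ fromℤ (ℤ.- i)
  neg-fromℤ (+ 0)     = refl
  neg-fromℤ (+ suc n) = refl
  neg-fromℤ -[1+ n ]  = refl

+-frac-neg≡ceiling : ∀ q → q + frac (- q) ≡ ceiling q / 1
+-frac-neg≡ceiling q@(mkℚ _ _ _) = begin
  q + (- q - floor (- q) / 1)     ≡⟨ sym (+-assoc q (- q) _) ⟩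
  (q - q) - floor (- q) / 1       ≡⟨ cong (_- floor (- q) / 1) (+-inverseʳ q) ⟩
  0ℚ - floor (- q) / 1            ≡⟨ +-identityˡ _ ⟩
  - (floor (- q) / 1)             ≡⟨ neg-/1 (floor (- q)) ⟩
  ceiling q / 1                   ∎
  where open ≡-Reasoning

≤∧≢⇒< : ∀ {p q} → p ≤ q → p ≢ q → p < q
≤∧≢⇒< {p} {q} p≤q p≢q with q ≤? p
... | yes q≤p = contradiction (≤-antisym p≤q q≤p) p≢q
... | no q≰p  = ≰⇒> q≰p

1≤+frac-neg : ∀ {q} → 0ℚ ≤ q → 0ℚ ≤ frac (- q) → q ≢ 0ℚ → 1ℚ ≤ q + frac (- q)
1≤+frac-neg {q} 0≤q 0≤frac-q q≢0 = begin
  1ℚ              ≤⟨ 0</1⇒1≤/1 (ceiling q) (<-respʳ-≡ (+-frac-neg≡ceiling q) 0<q+frac-q) ⟩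
  ceiling q / 1   ≡⟨ sym (+-frac-neg≡ceiling q) ⟩
  q + frac (- q)  ∎
  where
  open ≤-Reasoning
  0<q+frac-q : 0ℚ < q + frac (- q)
  0<q+frac-q = +-mono-<-≤ (≤∧≢⇒< 0≤q (q≢0 ∘ sym)) 0≤frac-q

wt-∷≤ : ∀ {e q} (x : Pt e) → 0ℚ ≤ q → 0ℚ ≤ frac (- q) →
        (+ wt (q ∷ x)) / 1 ≤ (q + frac (- q)) + (+ wt x) / 1
wt-∷≤ {q = q} x 0≤q 0≤frac-q with q ≟ 0ℚ
... | yes _  = ≤-trans (≤-reflexive (sym (+-identityˡ _)))
                 (+-monoˡ-≤ ((+ wt x) / 1) (+-mono-≤ 0≤q 0≤frac-q))
... | no q≢0 = ≤-trans (≤-reflexive (/1-homo-+ (+ 1) (+ wt x)))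
                 (+-monoˡ-≤ ((+ wt x) / 1) (1≤+frac-neg 0≤q 0≤frac-q q≢0))

wt≤ht+ht⊖ : ∀ {e} (x : Pt e) → Reduced x → Reduced (⊖ x) → (+ wt x) / 1 ≤ ht x + ht (⊖ x)
wt≤ht+ht⊖ []      _                   _                        = ≤-refl
wt≤ht+ht⊖ (q ∷ x) ((0≤q , _) ∷ red-x) ((0≤frac-q , _) ∷ red-⊖x) = begin
  (+ wt (q ∷ x)) / 1                    ≤⟨ wt-∷≤ x 0≤q 0≤frac-q ⟩
  (q + frac (- q)) + (+ wt x) / 1       ≤⟨ +-monoʳ-≤ (q + frac (- q)) (wt≤ht+ht⊖ x red-x red-⊖x) ⟩
  (q + frac (- q)) + (ht x + ht (⊖ x))  ≡⟨ interchange q (frac (- q)) (ht x) (ht (⊖ x)) ⟩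
  (q + ht x) + (frac (- q) + ht (⊖ x))  ∎
  where open ≤-Reasoning

2*p≡p+p : ∀ p → (+ 2) / 1 * p ≡ p + p
2*p≡p+p p = begin
  (+ 2) / 1 * p      ≡⟨ cong (_* p) (/1-homo-+ (+ 1) (+ 1)) ⟩
  (1ℚ + 1ℚ) * p      ≡⟨ *-distribʳ-+ p 1ℚ 1ℚ ⟩
  1ℚ * p + 1ℚ * p    ≡⟨ cong₂ _+_ (*-identityˡ p) (*-identityˡ p) ⟩
  p + p              ∎
  where open ≡-Reasoning

lemma2p2 : (e : ℕ) (Λ : List (Pt e)) (s : ℚ) → IsFiniteSubgroup Λ → DegIs Λ s →
    ∀ x → x ∈ Λ → ((+ wt x) / 1) ≤ ((+ 2) / 1) * s
lemma2p2 _ _ s G (_ , ht≤s) x x∈Λ = begin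
  (+ wt x) / 1      ≤⟨ wt≤ht+ht⊖ x (reduced x x∈Λ) (reduced (⊖ x) ⊖x∈Λ) ⟩
  ht x + ht (⊖ x)   ≤⟨ +-mono-≤ (ht≤s x x∈Λ) (ht≤s (⊖ x) ⊖x∈Λ) ⟩
  s + s             ≡⟨ sym (2*p≡p+p s) ⟩
  (+ 2) / 1 * s     ∎
  where
  open IsFiniteSubgroup G
  open ≤-Reasoning
  ⊖x∈Λ = closed-neg x x∈Λ
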